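{- In the setting described in the context, for any pair of distinct triangles $T$ and $T'$ of $\mathcal T_4$, there are at least $\frac1{12}(t_4-2)$ triangles $T''\in\mathcal T_4$ with $T\leadsto T''\leadsto T'$.
   Context: Setting: Let $n,k\ge0$ be integers and let $G$ be an $n$-vertex graph which is edge-maximal subject to not containing $k+1$ pairwise vertex-disjoint triangles. Let $\mathcal T$ be a set of $k$ vertex-disjoint triangles in $G$ and $\mathcal M$ a maximum matching in $G-V(\mathcal T)$, where $\mathcal T$ is chosen among all sets of $k$ vertex-disjoint triangles of $G$ so as to maximise $|\mathcal M|$. Let $\mathcal I$ be the set of vertices covered neither by $\mathcal T$ nor by $\mathcal M$. An edge $uv$ sees a vertex $x$ of a triangle $xyz$ if $uvx$ is a triangle of $G$, and sees the triangle if it sees at least one of its vertices; a vertex $u$ sees the edge $xy$ of the triangle $xyz$ (and sees the triangle) if $uxy$ is a triangle. $\mathcal T_1$: triangles of $\mathcal T$ seen by at least two edges of $\mathcal M$; $\mathcal T_2$: triangles of $\mathcal T\setminus\mathcal T_1$ seen either by an edge of $\mathcal M$ and at least one vertex of $\mathcal I$, or by two vertices of $\mathcal I$. Start with $D=\mathcal T\setminus(\mathcal T_1\cup\mathcal T_2)$, $S=\emptyset$; while some triangle of $D$ sends at most $8(|D|-1)$ edges to the other triangles of $D$, move such a triangle from $D$ to $S$; finally $\mathcal T_3=S$, $\mathcal T_4=D$ (any outcome allowed). $t_4=|\mathcal T_4|$. For triangles $T,T',T''$ we write $T\leadsto T''\leadsto T'$ ($T''$ connects $T$ to $T'$) if either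 there are at least $8$ edges of $G$ from $T''$ to $T$ and at least $8$ from $T''$ to $T'$, or there are $9$ edges from $T''$ to $T$ and at least $7$ from $T''$ to $T'$. -}

module Defs where

open import Data.Nat using (ℕ; zero; suc; _+_; _*_; _∸_; _≤_; _<_; _≤ᵇ_; _≡ᵇ_)
open import Data.Bool using (Bool; true; false; _∧_; _∨_; not)
open import Data.Fin using (Fin; _≟_)
open import Data.Product using (Σ; _×_; _,_)
open import Data.List using (List; []; _∷_; length; map; concatMap; filterᵇ; allFin; removeAt; lookup; _++_)
open import Data.Bool.ListAction using (any)
open import Data.Nat.ListAction using (sum)
open import Data.List.Relation.Unary.All using (All)
open import Data.List.Relation.Unary.Unique.Propositional using (Unique)
open import Relation.Nullary using (¬_; does)
open import Relation.Binary.PropositionalEquality using (_≡_; _≢_)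

Adj : ℕ → Set
Adj n = Fin n → Fin n → Bool

record Graph (n : ℕ) : Set where
  field
    adj    : Adj n
    sym    : ∀ x y → adj x y ≡ adj y x
    irrefl : ∀ x → adj x x ≡ false
open Graph public

eqᵇ : ∀ {n} → Fin n → Fin n → Bool
eqᵇ x y = does (x ≟ y)

addEdge : ∀ {n} → Adj n → Fin n → Fin n → Adj n
addEdge a u v x y = a x y ∨ ((eqᵇ x u ∧ eqᵇ y v) ∨ (eqᵇ x v ∧ eqᵇ y u))

count : ∀ {A : Set} → (A → Bool) → List A → ℕ
count p xs = length (filterᵇ p xs)

memᵇ : ∀ {n} → Fin n → List (Fin n) → Bool
memᵇ x xs = any (eqᵇ x) xs

record Tri (n : ℕ) : Set where
  constructor tri
  field
    tx ty tz : Fin n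
open Tri public

verts : ∀ {n} → Tri n → List (Fin n)
verts t = tx t ∷ ty t ∷ tz t ∷ []

IsTriangle : ∀ {n} → Adj n → Tri n → Set
IsTriangle a t = (a (tx t) (ty t) ∧ a (ty t) (tz t) ∧ a (tx t) (tz t)) ≡ true

vertsAll : ∀ {n} → List (Tri n) → List (Fin n)
vertsAll ts = concatMap verts ts

DisjointTriangles : ∀ {n} → Adj n → ℕ → List (Tri n) → Set
DisjointTriangles a m ts = (length ts ≡ m) × All (IsTriangle a) ts × Unique (vertsAll ts)

HasDisjointTriangles : ∀ {n} → Adj n → ℕ → Set
HasDisjointTriangles a m = Σ (List (Tri _)) λ ts → DisjointTriangles a m ts

EdgeMaximal : ∀ {n} → ℕ → Graph n → Set
EdgeMaximal k G =
  ¬ HasDisjointTriangles (adj G) (suc k) ×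
  (∀ u v → u ≢ v → adj G u v ≡ false → HasDisjointTriangles (addEdge (adj G) u v) (suc k))

Edge : ℕ → Set
Edge n = Fin n × Fin n

edgeVerts : ∀ {n} → Edge n → List (Fin n)
edgeVerts (u , v) = u ∷ v ∷ []

matchVerts : ∀ {n} → List (Edge n) → List (Fin n)
matchVerts ms = concatMap edgeVerts ms

IsMatchingOutside : ∀ {n} → Adj n → List (Tri n) → List (Edge n) → Set
IsMatchingOutside a ts ms =
  All (λ e → a (Data.Product.proj₁ e) (Data.Product.proj₂ e) ≡ true) ms ×
  Unique (vertsAll ts ++ matchVerts ms)

IsMaxMatchingOutside : ∀ {n} → Adj n → List (Tri n) → List (Edge n) → Set
IsMaxMatchingOutside a ts ms =
  IsMatchingOutside a ts ms ×
  (∀ ms' → IsMatchingOutside a ts ms' → length ms' ≤ length ms)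

-- ts is chosen among all families of k disjoint triangles to maximise |M|
IsOptimalChoice : ∀ {n} → Adj n → ℕ → List (Edge n) → Set
IsOptimalChoice a k ms =
  ∀ ts' ms' → DisjointTriangles a k ts' → IsMatchingOutside a ts' ms' → length ms' ≤ length ms

uncovered : ∀ {n} → List (Tri n) → List (Edge n) → List (Fin n)
uncovered {n} ts ms = filterᵇ (λ x → not (memᵇ x (vertsAll ts) ∨ memᵇ x (matchVerts ms))) (allFin n)

edgeSeesVertex : ∀ {n} → Adj n → Edge n → Fin n → Bool
edgeSeesVertex a (u , v) x = a u v ∧ a u x ∧ a v x

edgeSeesTri : ∀ {n} → Adj n → Edge n → Tri n → Bool
edgeSeesTri a e t = any (edgeSeesVertex a e) (verts t)

vertexSeesTri : ∀ {n} → Adj n → Fin n → Tri n → Bool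
vertexSeesTri a u t =
  (a u (tx t) ∧ a u (ty t)) ∨ (a u (ty t) ∧ a u (tz t)) ∨ (a u (tx t) ∧ a u (tz t))

inT1 : ∀ {n} → Adj n → List (Edge n) → Tri n → Bool
inT1 a ms t = 2 ≤ᵇ count (λ e → edgeSeesTri a e t) ms

inT2 : ∀ {n} → Adj n → List (Tri n) → List (Edge n) → Tri n → Bool
inT2 a ts ms t =
  not (inT1 a ms t) ∧
  ((any (λ e → edgeSeesTri a e t) ms ∧ any (λ u → vertexSeesTri a u t) (uncovered ts ms))
   ∨ (2 ≤ᵇ count (λ u → vertexSeesTri a u t) (uncovered ts ms)))

initialD : ∀ {n} → Adj n → List (Tri n) → List (Edge n) → List (Tri n)
initialD a ts ms = filterᵇ (λ t → not (inT1 a ms t ∨ inT2 a ts ms t)) ts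

edgesBetween : ∀ {n} → Adj n → Tri n → Tri n → ℕ
edgesBetween a t t' = sum (map (λ x → count (a x) (verts t')) (verts t))

sendsOut : ∀ {n} → Adj n → (D : List (Tri n)) → Fin (length D) → ℕ
sendsOut a D i = sum (map (edgesBetween a (lookup D i)) (removeAt D i))

data Peel {n} (a : Adj n) : List (Tri n) → List (Tri n) → Set where
  done : ∀ D → Peel a D D
  step : ∀ D D' (i : Fin (length D)) →
         sendsOut a D i ≤ 8 * (length D ∸ 1) →
         Peel a (removeAt D i) D' → Peel a D D'

-- the while loop has terminated
Stable : ∀ {n} → Adj n → List (Tri n) → Set
Stable a D = ∀ (i : Fin (length D)) → 8 * (length D ∸ 1) < sendsOut a D i

-- T4 is a possible final value of D
IsT4 : ∀ {n} → Adj n → List (Tri n) → List (Edge n) → List (Tri n) → Set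
IsT4 a ts ms t4 = Peel a (initialD a ts ms) t4 × Stable a t4

connects : ∀ {n} → Adj n → Tri n → Tri n → Tri n → Bool
connects a t t'' t' =
  ((8 ≤ᵇ edgesBetween a t'' t) ∧ (8 ≤ᵇ edgesBetween a t'' t'))
  ∨ ((edgesBetween a t'' t ≡ᵇ 9) ∧ (7 ≤ᵇ edgesBetween a t'' t'))

-- Let T'' range over 𝒯₄ and write d(T'') = 9 − e(T'',T), d'(T'') = 9 − e(T'',T') for
-- the number of non-edges towards T and T'.  Stability of 𝒯₄ at T says that T sends
-- more than 8(t₄ − 1) edges to the other triangles, so the deficits d sum to at most
-- t₄ + 1 over 𝒯₄ (T itself contributing 3); likewise for d'.  A case check on the
-- counts shows 3d + 2d' ≥ 6 whenever T ⇝ T'' ⇝ T' fails, so summing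
-- 3d + 2d' + 6[T ⇝ T'' ⇝ T'] over 𝒯₄ gives 6t₄ + 3 ≤ 5(t₄ + 1) + 6C, where C is the
-- number of connecting triangles; hence t₄ ≤ 6C + 2, which is even stronger than claimed.
module Submission where

open import Defs
open import Data.Nat using (ℕ; suc; _+_; _*_; _∸_; _≤_; _<_; _≤?_; _≤ᵇ_; _≡ᵇ_; z≤n; s≤s)
open import Data.Nat.Properties
open import Data.Nat.ListAction using (sum)
open import Data.Nat.Tactic.RingSolver using (solve-∀)
open import Data.Bool using (Bool; true; false; _∧_; _∨_)
open import Data.Fin using (Fin; zero; suc; toℕ; fromℕ<)
import Data.Fin.Properties as Fin
open import Data.Product using (_×_; _,_; proj₁)
open import Data.List using (List; []; _∷_; length; map; removeAt; lookup)
open import Data.List.Properties using (length-filter; length-removeAt′; map-cong)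
open import Data.List.Relation.Unary.All as All using (All)
open import Data.List.Relation.Unary.Any using (here; there; index)
open import Data.List.Relation.Unary.Any.Properties using (lookup-index)
open import Data.List.Membership.Propositional using (_∈_)
open import Data.List.Membership.Propositional.Properties using (∈-filter⁻)
open import Data.Unit using (tt)
open import Function using (_∘_)
open import Relation.Nullary.Decidable using (T?; toWitness)
open import Relation.Binary.PropositionalEquality as Eq using (_≡_; _≢_; refl; cong; cong₂; subst; subst₂; _≗_)

indicator : Bool → ℕ
indicator true  = 1
indicator false = 0

module _ {A : Set} where

  count-∷ : ∀ (p : A → Bool) x xs → count p (x ∷ xs) ≡ indicator (p x) + count p xs
  count-∷ p x xs with p x
  ... | true  = refl
  ... | false = refl

  count-∷³ : ∀ (p : A → Bool) x y z →
             count p (x ∷ y ∷ z ∷ []) ≡ indicator (p x) + (indicator (p y) + (indicator (p z) + 0))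
  count-∷³ p x y z rewrite count-∷ p x (y ∷ z ∷ []) | count-∷ p y (z ∷ []) | count-∷ p z [] = refl

  count≤length : ∀ (p : A → Bool) xs → count p xs ≤ length xs
  count≤length p = length-filter (T? ∘ p)

  count-cong : ∀ {p q : A → Bool} → p ≗ q → count p ≗ count q
  count-cong p≗q []       = refl
  count-cong {p} {q} p≗q (x ∷ xs) rewrite count-∷ p x xs | count-∷ q x xs =
    cong₂ _+_ (cong indicator (p≗q x)) (count-cong p≗q xs)

  sum-map-+ : ∀ (f g : A → ℕ) xs →
              sum (map (λ x → f x + g x) xs) ≡ sum (map f xs) + sum (map g xs)
  sum-map-+ f g []       = refl
  sum-map-+ f g (x ∷ xs) rewrite sum-map-+ f g xs = +-+-assoc-swap (f x) (g x) _ _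
    where
    +-+-assoc-swap : ∀ a b c d → a + b + (c + d) ≡ a + c + (b + d)
    +-+-assoc-swap = solve-∀

  sum-map-* : ∀ k (f : A → ℕ) xs → sum (map (λ x → k * f x) xs) ≡ k * sum (map f xs)
  sum-map-* k f []       = Eq.sym (*-zeroʳ k)
  sum-map-* k f (x ∷ xs) rewrite sum-map-* k f xs = Eq.sym (*-distribˡ-+ k (f x) _)

  sum-map-const : ∀ k (xs : List A) → sum (map (λ _ → k) xs) ≡ k * length xs
  sum-map-const k []       = Eq.sym (*-zeroʳ k)
  sum-map-const k (x ∷ xs) rewrite sum-map-const k xs = Eq.sym (*-suc k (length xs))

  sum-map-count : ∀ (p : A → Bool) xs → sum (map (indicator ∘ p) xs) ≡ count p xs
  sum-map-count p []       = refl
  sum-map-count p (x ∷ xs) rewrite count-∷ p x xs = cong (indicator (p x) +_) (sum-map-count p xs)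

  sum-map-∸ : ∀ m (f : A → ℕ) → (∀ x → f x ≤ m) → ∀ xs →
              sum (map (λ x → m ∸ f x) xs) + sum (map f xs) ≡ m * length xs
  sum-map-∸ m f f≤m xs = begin
    sum (map (λ x → m ∸ f x) xs) + sum (map f xs) ≡⟨ sum-map-+ (λ x → m ∸ f x) f xs ⟨
    sum (map (λ x → m ∸ f x + f x) xs)             ≡⟨ cong sum (map-cong (λ x → m∸n+n≡m (f≤m x)) xs) ⟩
    sum (map (λ _ → m) xs)                         ≡⟨ sum-map-const m xs ⟩
    m * length xs                                  ∎
    where open Eq.≡-Reasoning

  *-length≤sum-map : ∀ c (f : A → ℕ) → (∀ x → c ≤ f x) → ∀ xs → c * length xs ≤ sum (map f xs)
  *-length≤sum-map c f c≤f []       rewrite *-zeroʳ c = z≤n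
  *-length≤sum-map c f c≤f (x ∷ xs) rewrite *-suc c (length xs) =
    +-mono-≤ (c≤f x) (*-length≤sum-map c f c≤f xs)

  sum-map-removeAt : ∀ (f : A → ℕ) {x} xs (x∈xs : x ∈ xs) →
                     sum (map f xs) ≡ f x + sum (map f (removeAt xs (index x∈xs)))
  sum-map-removeAt f (y ∷ ys) (here refl)  = refl
  sum-map-removeAt f {x} (y ∷ ys) (there x∈ys) rewrite sum-map-removeAt f ys x∈ys =
    +-comm-middle (f y) (f x) (sum (map f (removeAt ys (index x∈ys))))
    where
    +-comm-middle : ∀ a b c → a + (b + c) ≡ b + (a + c)
    +-comm-middle = solve-∀

  ∈-removeAt⁻ : ∀ {x : A} xs i → x ∈ removeAt xs i → x ∈ xs
  ∈-removeAt⁻ (y ∷ ys) zero    x∈      = there x∈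
  ∈-removeAt⁻ (y ∷ ys) (suc i) (here e)  = here e
  ∈-removeAt⁻ (y ∷ ys) (suc i) (there x∈) = there (∈-removeAt⁻ ys i x∈)

sum-map-count-swap : ∀ {A B : Set} (R : A → B → Bool) xs ys →
                     sum (map (λ x → count (R x) ys) xs) ≡ sum (map (λ y → count (λ x → R x y) xs) ys)
sum-map-count-swap R []       ys = Eq.sym (sum-map-const 0 ys)
sum-map-count-swap R (x ∷ xs) ys = begin
  count (R x) ys + sum (map (λ x → count (R x) ys) xs)
    ≡⟨ cong₂ _+_ (Eq.sym (sum-map-count (R x) ys)) (sum-map-count-swap R xs ys) ⟩
  sum (map (λ y → indicator (R x y)) ys) + sum (map (λ y → count (λ x → R x y) xs) ys)
    ≡⟨ sum-map-+ (λ y → indicator (R x y)) (λ y → count (λ x → R x y) xs) ys ⟨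
  sum (map (λ y → indicator (R x y) + count (λ x → R x y) xs) ys)
    ≡⟨ cong sum (map-cong (λ y → count-∷ (λ x → R x y) x xs) ys) ⟨
  sum (map (λ y → count (λ x → R x y) (x ∷ xs)) ys) ∎
  where open Eq.≡-Reasoning

edgesBetween≤9 : ∀ {n} (a : Adj n) t u → edgesBetween a t u ≤ 9
edgesBetween≤9 a t u =
  +-mono-≤ (≤3 (tx t)) (+-mono-≤ (≤3 (ty t)) (+-mono-≤ (≤3 (tz t)) z≤n))
  where
  ≤3 : ∀ x → count (a x) (verts u) ≤ 3
  ≤3 x = count≤length (a x) (verts u)

triangle-edges : ∀ {n} (a : Adj n) x y z → IsTriangle a (tri x y z) →
                 a x y ≡ true × a y z ≡ true × a x z ≡ true
triangle-edges a x y z isTri with a x y | a y z | a x z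
triangle-edges a x y z refl | true | true | true = refl , refl , refl

module _ {n} (G : Graph n) where

  edgesBetween-sym : ∀ t u → edgesBetween (adj G) t u ≡ edgesBetween (adj G) u t
  edgesBetween-sym t u = begin
    sum (map (λ x → count (adj G x) (verts u)) (verts t))
      ≡⟨ sum-map-count-swap (adj G) (verts t) (verts u) ⟩
    sum (map (λ y → count (λ x → adj G x y) (verts t)) (verts u))
      ≡⟨ cong sum (map-cong (λ y → count-cong (λ x → sym G x y) (verts t)) (verts u)) ⟩
    sum (map (λ y → count (adj G y) (verts t)) (verts u)) ∎
    where open Eq.≡-Reasoning

  edgesBetween-self : ∀ t → IsTriangle (adj G) t → edgesBetween (adj G) t t ≡ 6
  edgesBetween-self (tri x y z) isTri with triangle-edges (adj G) x y z isTri
  ... | xy , yz , xz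
    rewrite count-∷³ (adj G x) x y z | count-∷³ (adj G y) x y z | count-∷³ (adj G z) x y z
          | irrefl G x | irrefl G y | irrefl G z
          | sym G y x | sym G z y | sym G z x | xy | yz | xz = refl

nonEdgesBetween : ∀ {n} → Adj n → Tri n → Tri n → ℕ
nonEdgesBetween a t u = 9 ∸ edgesBetween a t u

connectsCounts : ℕ → ℕ → Bool
connectsCounts e e' = ((8 ≤ᵇ e) ∧ (8 ≤ᵇ e')) ∨ ((e ≡ᵇ 9) ∧ (7 ≤ᵇ e'))

connectionWeight : ℕ → ℕ → ℕ
connectionWeight e e' = 3 * (9 ∸ e) + 2 * (9 ∸ e') + 6 * indicator (connectsCounts e e')

9≤connectionWeight-6 : ∀ e' → 9 ≤ connectionWeight 6 e'
9≤connectionWeight-6 e' = ≤-trans (m≤m+n 9 (2 * (9 ∸ e'))) (m≤m+n _ _)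

-- A triangle T'' that fails T ⇝ T'' ⇝ T' has e(T'',T) ≤ 7, or e(T'',T') ≤ 6,
-- or e(T'',T) = 8 and e(T'',T') = 7; each case has 3d + 2d' ≥ 6.
6≤connectionWeight : ∀ e e' → e ≤ 9 → e' ≤ 9 → 6 ≤ connectionWeight e e'
6≤connectionWeight e e' e≤9 e'≤9 =
  subst₂ (λ i j → 6 ≤ connectionWeight i j) (Fin.toℕ-fromℕ< (s≤s e≤9)) (Fin.toℕ-fromℕ< (s≤s e'≤9))
    (table (fromℕ< (s≤s e≤9)) (fromℕ< (s≤s e'≤9)))
  where
  table : ∀ (i j : Fin 10) → 6 ≤ connectionWeight (toℕ i) (toℕ j)
  table = toWitness {a? = Fin.all? λ i → Fin.all? λ j → 6 ≤? connectionWeight (toℕ i) (toℕ j)} tt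

module StableTriangles {n} (G : Graph n) {D : List (Tri n)}
         (triangles : All (IsTriangle (adj G)) D) (stable : Stable (adj G) D) where

  private
    a = adj G

  sum-edgesBetween-removeAt : ∀ {s} (s∈D : s ∈ D) →
    8 * length (removeAt D (index s∈D)) < sum (map (λ u → edgesBetween a u s) (removeAt D (index s∈D)))
  sum-edgesBetween-removeAt {s} s∈D = subst₂ _<_ size total (stable i)
    where
    i = index s∈D
    R = removeAt D i
    size : 8 * (length D ∸ 1) ≡ 8 * length R
    size = cong (λ m → 8 * (m ∸ 1)) (length-removeAt′ D i)
    total : sendsOut a D i ≡ sum (map (λ u → edgesBetween a u s) R)
    total = begin
      sum (map (edgesBetween a (lookup D i)) R)
        ≡⟨ cong (λ w → sum (map (edgesBetween a w) R)) (lookup-index s∈D) ⟨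
      sum (map (edgesBetween a s) R)
        ≡⟨ cong sum (map-cong (edgesBetween-sym G s) R) ⟩
      sum (map (λ u → edgesBetween a u s) R) ∎
      where open Eq.≡-Reasoning

  sum-nonEdgesBetween≤ : ∀ {s} → s ∈ D → sum (map (λ u → nonEdgesBetween a u s) D) ≤ suc (length D)
  sum-nonEdgesBetween≤ {s} s∈D =
    subst (λ m → deficit ≤ suc m) (Eq.sym (length-removeAt′ D (index s∈D)))
      (budget deficit (sum (map e R)) (length R) partition (sum-edgesBetween-removeAt s∈D))
    where
    R = removeAt D (index s∈D)
    e = λ u → edgesBetween a u s
    deficit = sum (map (λ u → nonEdgesBetween a u s) D)
    partition : deficit + (6 + sum (map e R)) ≡ 9 * suc (length R)
    partition = begin
      sum (map (λ u → 9 ∸ e u) D) + (6 + sum (map e R))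
        ≡⟨ cong (λ x → sum (map (λ u → 9 ∸ e u) D) + (x + sum (map e R)))
                (edgesBetween-self G s (All.lookup triangles s∈D)) ⟨
      sum (map (λ u → 9 ∸ e u) D) + (e s + sum (map e R))
        ≡⟨ cong (sum (map (λ u → 9 ∸ e u) D) +_) (sum-map-removeAt e D s∈D) ⟨
      sum (map (λ u → 9 ∸ e u) D) + sum (map e D)
        ≡⟨ sum-map-∸ 9 e (λ u → edgesBetween≤9 a u s) D ⟩
      9 * length D
        ≡⟨ cong (9 *_) (length-removeAt′ D (index s∈D)) ⟩
      9 * suc (length R) ∎
      where open Eq.≡-Reasoning
    budget : ∀ d S L → d + (6 + S) ≡ 9 * suc L → 8 * L < S → d ≤ suc (suc L)
    budget d S L eq 8L<S = +-cancelʳ-≤ (7 + 8 * L) d (2 + L) (begin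
      d + (7 + 8 * L) ≤⟨ +-monoʳ-≤ d (+-monoʳ-≤ 6 8L<S) ⟩
      d + (6 + S)     ≡⟨ eq ⟩
      9 * suc L       ≡⟨ 9*suc L ⟩
      2 + L + (7 + 8 * L) ∎)
      where
      open ≤-Reasoning
      9*suc : ∀ L → 9 * suc L ≡ 2 + L + (7 + 8 * L)
      9*suc = solve-∀

  length≤6*count-connects+2 : ∀ {t t'} → t ∈ D → t' ∈ D →
                              length D ≤ 6 * count (λ u → connects a t u t') D + 2
  length≤6*count-connects+2 {t} {t'} t∈D t'∈D = cancel (length D) C (≤-trans lower upper)
    where
    C = count (λ u → connects a t u t') D
    R = removeAt D (index t∈D)
    N N′ : Tri n → ℕ
    N  u = nonEdgesBetween a u t
    N′ u = nonEdgesBetween a u t'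
    w : Tri n → ℕ
    w u = connectionWeight (edgesBetween a u t) (edgesBetween a u t')

    6≤w : ∀ u → 6 ≤ w u
    6≤w u = 6≤connectionWeight _ _ (edgesBetween≤9 a u t) (edgesBetween≤9 a u t')

    9≤w-t : 9 ≤ w t
    9≤w-t = subst (λ e → 9 ≤ connectionWeight e (edgesBetween a t t'))
                  (Eq.sym (edgesBetween-self G t (All.lookup triangles t∈D)))
                  (9≤connectionWeight-6 (edgesBetween a t t'))

    lower : 3 + 6 * length D ≤ sum (map w D)
    lower = begin
      3 + 6 * length D        ≡⟨ cong (λ m → 3 + 6 * m) (length-removeAt′ D (index t∈D)) ⟩
      3 + 6 * suc (length R)  ≡⟨ cong (3 +_) (*-suc 6 (length R)) ⟩
      9 + 6 * length R        ≤⟨ +-mono-≤ 9≤w-t (*-length≤sum-map 6 w 6≤w R) ⟩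
      w t + sum (map w R)     ≡⟨ sum-map-removeAt w D t∈D ⟨
      sum (map w D)           ∎
      where open ≤-Reasoning

    sum-map-w : sum (map w D) ≡ 3 * sum (map N D) + 2 * sum (map N′ D) + 6 * C
    sum-map-w = begin
      sum (map w D)
        ≡⟨ sum-map-+ (λ u → 3 * N u + 2 * N′ u) (λ u → 6 * χ u) D ⟩
      sum (map (λ u → 3 * N u + 2 * N′ u) D) + sum (map (λ u → 6 * χ u) D)
        ≡⟨ cong₂ _+_ (sum-map-+ (λ u → 3 * N u) (λ u → 2 * N′ u) D) (sum-map-* 6 χ D) ⟩
      sum (map (λ u → 3 * N u) D) + sum (map (λ u → 2 * N′ u) D) + 6 * sum (map χ D)
        ≡⟨ cong₂ _+_ (cong₂ _+_ (sum-map-* 3 N D) (sum-map-* 2 N′ D))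
                     (cong (6 *_) (sum-map-count (λ u → connects a t u t') D)) ⟩
      3 * sum (map N D) + 2 * sum (map N′ D) + 6 * C ∎
      where
      open Eq.≡-Reasoning
      χ : Tri n → ℕ
      χ u = indicator (connects a t u t')

    upper : sum (map w D) ≤ 3 * suc (length D) + 2 * suc (length D) + 6 * C
    upper = begin
      sum (map w D)                                  ≡⟨ sum-map-w ⟩
      3 * sum (map N D) + 2 * sum (map N′ D) + 6 * C ≤⟨ +-monoˡ-≤ (6 * C)
        (+-mono-≤ (*-monoʳ-≤ 3 (sum-nonEdgesBetween≤ t∈D)) (*-monoʳ-≤ 2 (sum-nonEdgesBetween≤ t'∈D))) ⟩
      3 * suc (length D) + 2 * suc (length D) + 6 * C ∎
      where open ≤-Reasoning

    cancel : ∀ m c → 3 + 6 * m ≤ 3 * suc m + 2 * suc m + 6 * c → m ≤ 6 * c + 2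
    cancel m c ineq =
      +-cancelʳ-≤ 3 m (6 * c + 2) (+-cancelˡ-≤ (5 * m) _ _ (subst₂ _≤_ (lhs m) (rhs m c) ineq))
      where
      lhs : ∀ m → 3 + 6 * m ≡ 5 * m + (m + 3)
      lhs = solve-∀
      rhs : ∀ m c → 3 * suc m + 2 * suc m + 6 * c ≡ 5 * m + (6 * c + 2 + 3)
      rhs = solve-∀

Peel-⊆ : ∀ {n} {a : Adj n} {D D' x} → Peel a D D' → x ∈ D' → x ∈ D
Peel-⊆ (done _)            x∈D' = x∈D'
Peel-⊆ (step D _ i _ peel) x∈D' = ∈-removeAt⁻ D i (Peel-⊆ peel x∈D')

lemma5p2 : (n k : ℕ) (G : Graph n) → EdgeMaximal k G →
    (ts : List (Tri n)) → DisjointTriangles (adj G) k ts →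
    (ms : List (Edge n)) → IsMaxMatchingOutside (adj G) ts ms →
    IsOptimalChoice (adj G) k ms →
    (t4 : List (Tri n)) → IsT4 (adj G) ts ms t4 →
    (t t' : Tri n) → t ∈ t4 → t' ∈ t4 → t ≢ t' →
    length t4 ≤ 12 * count (λ t'' → connects (adj G) t t'' t') t4 + 2
lemma5p2 n k G _ ts (_ , triangles , _) ms _ _ t4 (peel , stable) t t' t∈t4 t'∈t4 _ =
  ≤-trans (StableTriangles.length≤6*count-connects+2 G t4-triangles stable t∈t4 t'∈t4)
          (+-monoˡ-≤ 2 (*-monoˡ-≤ (count (λ t'' → connects (adj G) t t'' t') t4) 6≤12))
  where
  6≤12 : 6 ≤ 12
  6≤12 = m≤m+n 6 6
  t4-triangles : All (IsTriangle (adj G)) t4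
  t4-triangles = All.tabulate λ u∈t4 →
    All.lookup triangles (proj₁ (∈-filter⁻ (T? ∘ _) (Peel-⊆ peel u∈t4)))
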